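{- For every natural number $n$, $\Delta^\ast_{n+1} = \Sigma^\ast_{n+1}\cap\Pi^\ast_{n+1}$.
   Context: Formulas are built over a relational signature from atoms (the class ${\sf AT}$, which includes $\top,\bot$) using $\neg,\wedge,\vee,\to,\exists,\forall$. Define $\Sigma^\ast_0=\Pi^\ast_0=\emptyset$ and, simultaneously, $\Sigma^\ast_{n+1}$ and $\Pi^\ast_{n+1}$ as the least classes such that: ${\sf AT}\subseteq\Sigma^\ast_{n+1}$; $\neg A\in\Sigma^\ast_{n+1}$ for $A\in\Pi^\ast_{n+1}$; $A\wedge B, A\vee B\in\Sigma^\ast_{n+1}$ for $A,B\in\Sigma^\ast_{n+1}$; $A\to B\in\Sigma^\ast_{n+1}$ for $A\in\Pi^\ast_{n+1}$, $B\in\Sigma^\ast_{n+1}$; $\exists vA\in\Sigma^\ast_{n+1}$ for $A\in\Sigma^\ast_{n+1}$; $\forall vA\in\Sigma^\ast_{n+1}$ for $A\in\Pi^\ast_n$; and dually ${\sf AT}\subseteq\Pi^\ast_{n+1}$; $\neg A\in\Pi^\ast_{n+1}$ for $A\in\Sigma^\ast_{n+1}$; $A\wedge B,A\vee B\in\Pi^\ast_{n+1}$ for $A,B\in\Pi^\ast_{n+1}$; $A\to B\in\Pi^\ast_{n+1}$ for $A\in\Sigma^\ast_{n+1}$, $B\in\Pi^\ast_{n+1}$; $\forall vA\in\Pi^\ast_{n+1}$ for $A\in\Pi^\ast_{n+1}$; $\exists vA\in\Pi^\ast_{n+1}$ for $A\in\Sigma^\ast_n$. Define $\Delta^\ast_{n+1}$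 as the least class containing ${\sf AT}$, closed under $\neg,\wedge,\vee,\to$, and containing $\exists vA$ for $A\in\Sigma^\ast_n$ and $\forall vA$ for $A\in\Pi^\ast_n$. -}

module Defs where

open import Data.Nat using (ℕ; zero; suc)
open import Data.Vec using (Vec)
open import Data.Product using (_×_)

Var : Set
Var = ℕ

record Signature : Set₁ where
  field
    Rel   : Set
    arity : Rel → ℕ
open Signature public

module _ (S : Signature) where

  data Formula : Set where
    rel  : (R : Rel S) → Vec Var (arity S R) → Formula
    ⊤′ ⊥′ : Formula
    ¬′_  : Formula → Formula
    _∧′_ _∨′_ _⇒′_ : Formula → Formula → Formula
    ∃′ ∀′ : Var → Formula → Formula

  data AT : Formula → Set where
    at-rel : ∀ R vs → AT (rel R vs)
    at-⊤   : AT ⊤′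
    at-⊥   : AT ⊥′

  -- Σ*_n and Π*_n; both are empty at index 0 (no constructor has index 0).
  data Σ* : ℕ → Formula → Set
  data Π* : ℕ → Formula → Set

  data Σ* where
    at  : ∀ {n A} → AT A → Σ* (suc n) A
    neg : ∀ {n A} → Π* (suc n) A → Σ* (suc n) (¬′ A)
    and : ∀ {n A B} → Σ* (suc n) A → Σ* (suc n) B → Σ* (suc n) (A ∧′ B)
    or  : ∀ {n A B} → Σ* (suc n) A → Σ* (suc n) B → Σ* (suc n) (A ∨′ B)
    imp : ∀ {n A B} → Π* (suc n) A → Σ* (suc n) B → Σ* (suc n) (A ⇒′ B)
    ex  : ∀ {n v A} → Σ* (suc n) A → Σ* (suc n) (∃′ v A)
    all : ∀ {n v A} → Π* n A → Σ* (suc n) (∀′ v A)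

  data Π* where
    at  : ∀ {n A} → AT A → Π* (suc n) A
    neg : ∀ {n A} → Σ* (suc n) A → Π* (suc n) (¬′ A)
    and : ∀ {n A B} → Π* (suc n) A → Π* (suc n) B → Π* (suc n) (A ∧′ B)
    or  : ∀ {n A B} → Π* (suc n) A → Π* (suc n) B → Π* (suc n) (A ∨′ B)
    imp : ∀ {n A B} → Σ* (suc n) A → Π* (suc n) B → Π* (suc n) (A ⇒′ B)
    all : ∀ {n v A} → Π* (suc n) A → Π* (suc n) (∀′ v A)
    ex  : ∀ {n v A} → Σ* n A → Π* (suc n) (∃′ v A)

  data Δ* : ℕ → Formula → Set where
    at  : ∀ {n A} → AT A → Δ* (suc n) A
    neg : ∀ {n A} → Δ* (suc n) A → Δ* (suc n) (¬′ A)
    and : ∀ {n A B} → Δ* (suc n) A → Δ* (suc n) B → Δ* (suc n) (A ∧′ B)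
    or  : ∀ {n A B} → Δ* (suc n) A → Δ* (suc n) B → Δ* (suc n) (A ∨′ B)
    imp : ∀ {n A B} → Δ* (suc n) A → Δ* (suc n) B → Δ* (suc n) (A ⇒′ B)
    ex  : ∀ {n v A} → Σ* n A → Δ* (suc n) (∃′ v A)
    all : ∀ {n v A} → Π* n A → Δ* (suc n) (∀′ v A)

-- Since Σ*ₙ ⊆ Σ*ₙ₊₁ and
-- Π*ₙ ⊆ Π*ₙ₊₁, the quantified generators of Δ*ₙ₊₁ lie in both Σ*ₙ₊₁ and Π*ₙ₊₁,
-- and the connectives preserve membership in both. Conversely, in a formula of
-- Σ*ₙ₊₁ ∩ Π*ₙ₊₁ the Π*ₙ₊₁ rule for ∃ forces the matrix of an existential into
-- Σ*ₙ, and the Σ*ₙ₊₁ rule for ∀ forces that of a universal into Π*ₙ.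
module Submission where

open import Defs
open import Data.Nat using (ℕ; suc)
open import Data.Product using (_×_; _,_)

module _ {S : Signature} where

  Σ*-suc : ∀ {n A} → Σ* S n A → Σ* S (suc n) A
  Π*-suc : ∀ {n A} → Π* S n A → Π* S (suc n) A
  Σ*-suc (at a)    = at a
  Σ*-suc (neg p)   = neg (Π*-suc p)
  Σ*-suc (and s t) = and (Σ*-suc s) (Σ*-suc t)
  Σ*-suc (or s t)  = or (Σ*-suc s) (Σ*-suc t)
  Σ*-suc (imp p s) = imp (Π*-suc p) (Σ*-suc s)
  Σ*-suc (ex s)    = ex (Σ*-suc s)
  Σ*-suc (all p)   = all (Π*-suc p)
  Π*-suc (at a)    = at a
  Π*-suc (neg s)   = neg (Σ*-suc s)
  Π*-suc (and p q) = and (Π*-suc p) (Π*-suc q)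
  Π*-suc (or p q)  = or (Π*-suc p) (Π*-suc q)
  Π*-suc (imp s p) = imp (Σ*-suc s) (Π*-suc p)
  Π*-suc (all p)   = all (Π*-suc p)
  Π*-suc (ex s)    = ex (Σ*-suc s)

  Δ*⇒Σ* : ∀ {n A} → Δ* S (suc n) A → Σ* S (suc n) A
  Δ*⇒Π* : ∀ {n A} → Δ* S (suc n) A → Π* S (suc n) A
  Δ*⇒Σ* (at a)    = at a
  Δ*⇒Σ* (neg d)   = neg (Δ*⇒Π* d)
  Δ*⇒Σ* (and d e) = and (Δ*⇒Σ* d) (Δ*⇒Σ* e)
  Δ*⇒Σ* (or d e)  = or (Δ*⇒Σ* d) (Δ*⇒Σ* e)
  Δ*⇒Σ* (imp d e) = imp (Δ*⇒Π* d) (Δ*⇒Σ* e)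
  Δ*⇒Σ* (ex s)    = ex (Σ*-suc s)
  Δ*⇒Σ* (all p)   = all p
  Δ*⇒Π* (at a)    = at a
  Δ*⇒Π* (neg d)   = neg (Δ*⇒Σ* d)
  Δ*⇒Π* (and d e) = and (Δ*⇒Π* d) (Δ*⇒Π* e)
  Δ*⇒Π* (or d e)  = or (Δ*⇒Π* d) (Δ*⇒Π* e)
  Δ*⇒Π* (imp d e) = imp (Δ*⇒Σ* d) (Δ*⇒Π* e)
  Δ*⇒Π* (ex s)    = ex s
  Δ*⇒Π* (all p)   = all (Π*-suc p)

  Σ*∩Π*⇒Δ* : ∀ {n A} → Σ* S (suc n) A → Π* S (suc n) A → Δ* S (suc n) A
  Σ*∩Π*⇒Δ* (at a)    _         = at a
  Σ*∩Π*⇒Δ* (neg p)   (neg s)   = neg (Σ*∩Π*⇒Δ* s p)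
  Σ*∩Π*⇒Δ* (and s t) (and p q) = and (Σ*∩Π*⇒Δ* s p) (Σ*∩Π*⇒Δ* t q)
  Σ*∩Π*⇒Δ* (or s t)  (or p q)  = or (Σ*∩Π*⇒Δ* s p) (Σ*∩Π*⇒Δ* t q)
  Σ*∩Π*⇒Δ* (imp p t) (imp s q) = imp (Σ*∩Π*⇒Δ* s p) (Σ*∩Π*⇒Δ* t q)
  Σ*∩Π*⇒Δ* (ex _)    (ex s)    = ex s
  Σ*∩Π*⇒Δ* (all p)   _         = all p

mainTheorem18 : (S : Signature) (n : ℕ) (A : Formula S) →
    (Δ* S (suc n) A → Σ* S (suc n) A × Π* S (suc n) A) ×
    (Σ* S (suc n) A × Π* S (suc n) A → Δ* S (suc n) A)
mainTheorem18 S n A =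
  (λ d → Δ*⇒Σ* d , Δ*⇒Π* d) , λ { (s , p) → Σ*∩Π*⇒Δ* s p }
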